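{- Let $\mathcal{A}=\{a,b\}$ be a set with $a\neq b$ and let $\omega$ be the Thue–Morse word on $\mathcal{A}$. Then: (i) $\omega$ satisfies property $\spadesuit$ with constant $c=2$; (ii) $\omega$ satisfies property $\clubsuit$ with constant $c=0$.
   Context: The Thue–Morse sequence on $\{a,b\}$ is $(a_n)_{n\ge0}$ with $a_n=a$ if the number of $1$'s in the binary expansion of $n$ is even and $a_n=b$ otherwise; the Thue–Morse word is $a_0a_1a_2\cdots=abbabaabbaab\cdots$. For a finite word $\omega$, $|\omega|$ is its length and $\widetilde\omega$ its reversal. Given a real $c\ge0$, an infinite word $\omega$ has property $\spadesuit$ (resp. $\clubsuit$) with constant $c$ if $\omega$ is not ultimately periodic and there exist sequences $(U_n),(V_n),(W_n)$ of finite words such that for every $n\ge1$ the word $W_nU_nV_nU_n$ (resp. $W_nU_nV_n\widetilde{U_n}$) is a prefix of $\omega$, $\max(|V_n|/|U_n|,|W_n|/|U_n|)\le c$ for every $n\ge1$, and $(|U_n|)_n$ is unbounded. -}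

module Defs where

open import Data.Nat using (ℕ; zero; suc; _+_; _*_; _≤_; _<_; _≥_; _%_)
open import Data.Nat.Properties using ()
open import Data.List using (List; length; _++_; reverse; lookup)
open import Data.Fin using (toℕ)
open import Data.Product using (Σ; ∃; _×_; _,_)
open import Relation.Binary.PropositionalEquality using (_≡_)
open import Relation.Nullary using (¬_)

half : ℕ → ℕ
half zero = zero
half (suc zero) = zero
half (suc (suc n)) = suc (half n)

-- number of 1's in the binary expansion of n, computed with fuel k ≥ n
ones : ℕ → ℕ → ℕ
ones zero n = zero
ones (suc k) zero = zero
ones (suc k) (suc n) = (suc n % 2) + ones k (half (suc n))

popcount : ℕ → ℕ
popcount n = ones n n

module _ {A : Set} where

  InfWord : Set
  InfWord = ℕ → A

  IsPrefix : List A → InfWord → Set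
  IsPrefix u ω = ∀ i → ω (toℕ i) ≡ lookup u i

  UltPeriodic : InfWord → Set
  UltPeriodic ω = Σ ℕ λ p → Σ ℕ λ N → (0 < p) × (∀ n → N ≤ n → ω (n + p) ≡ ω n)

  thueMorse : A → A → InfWord
  thueMorse a b n with popcount n % 2
  ... | zero = a
  ... | suc _ = b

  -- Property ♠ with (natural-number) constant c.
  -- |V_n|/|U_n| ≤ c  is written  |V_n| ≤ c * |U_n|.
  Spade : ℕ → InfWord → Set
  Spade c ω =
    ¬ UltPeriodic ω ×
    Σ (ℕ → List A) λ U → Σ (ℕ → List A) λ V → Σ (ℕ → List A) λ W →
      (∀ n → 1 ≤ n → IsPrefix (W n ++ U n ++ V n ++ U n) ω) ×
      (∀ n → 1 ≤ n → length (V n) ≤ c * length (U n)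
                   × length (W n) ≤ c * length (U n)) ×
      (∀ B → Σ ℕ λ n → (1 ≤ n) × (B < length (U n)))

  Club : ℕ → InfWord → Set
  Club c ω =
    ¬ UltPeriodic ω ×
    Σ (ℕ → List A) λ U → Σ (ℕ → List A) λ V → Σ (ℕ → List A) λ W →
      (∀ n → 1 ≤ n → IsPrefix (W n ++ U n ++ V n ++ reverse (U n)) ω) ×
      (∀ n → 1 ≤ n → length (V n) ≤ c * length (U n)
                   × length (W n) ≤ c * length (U n)) ×
      (∀ B → Σ ℕ λ n → (1 ≤ n) × (B < length (U n)))

{-# OPTIONS --safe #-}
-- Over Bool the Thue–Morse word t satisfies t(2n) = t(n) and t(2n+1) = ¬t(n), so its
-- prefix of length 2^k is the block τ_k = μ^k(0) of the morphism μ(x) = x ¬x, and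
-- τ_{k+1} = τ_k ¬τ_k. Then τ_{k+2} = τ_k (¬τ_k ¬τ_k) τ_k witnesses ♠ with |V| = 2|U| and
-- W empty; since the reversal of τ_{2k+1} is its complement, τ_{2k+2} = τ_{2k+1} reverse(τ_{2k+1})
-- witnesses ♣ with V and W empty. Non-periodicity is a descent: an even eventual period 2q
-- of t halves to q, while an odd one makes t eventually constant, contradicting
-- t(2n+1) ≠ t(2n). Both properties survive the injective recoding false ↦ a, true ↦ b.
module Submission where

open import Defs
open import Data.Bool using (Bool; true; false; not; if_then_else_)
open import Data.Bool.Properties using (not-involutive; not-¬)
open import Data.Empty using (⊥-elim)
open import Data.Fin as Fin using ()
open import Data.List using (List; []; _∷_; _++_; map; reverse; length; concatMap; applyUpTo)
open import Data.List.Properties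
  using (map-++; length-map; length-++; ++-assoc; reverse-++; reverse-map; concatMap-++;
         map-∘; map-cong; map-id; length-applyUpTo; lookup-applyUpTo)
open import Data.Nat
  using (ℕ; zero; suc; _+_; _*_; _^_; _%_; _≡ᵇ_; _≤_; _<_; z≤n; s≤s; ⌊_/2⌋)
open import Data.Nat.DivMod using ([m+kn]%n≡m%n)
open import Data.Nat.Induction using (<-rec)
open import Data.Nat.Properties
  using (≤-refl; ≤-reflexive; ≤-trans; ≤-pred; m≤n⇒m≤1+n; n<1+n; m≤n*m; m<m*n; n≮0;
         ⌊n/2⌋<n; +-suc; +-comm; +-identityʳ; +-mono-≤; *-suc; *-comm; *-distribˡ-+; m^n>0;
         module ≤-Reasoning)
open import Data.Product using (Σ; _×_; _,_)
open import Data.Sum using (_⊎_; inj₁; inj₂)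
open import Function using (_∘_)
open import Function.Definitions using (Injective)
open import Relation.Binary.PropositionalEquality
  using (_≡_; _≢_; refl; sym; trans; cong; cong₂; subst; module ≡-Reasoning)
open import Relation.Nullary using (¬_)

map-not-involutive : ∀ xs → map not (map not xs) ≡ xs
map-not-involutive xs = trans (sym (map-∘ xs)) (trans (map-cong not-involutive xs) (map-id xs))

reverse-++-map-not : ∀ xs → reverse (xs ++ map not xs) ≡ map not (reverse xs) ++ reverse xs
reverse-++-map-not xs =
  trans (reverse-++ xs (map not xs)) (cong (_++ reverse xs) (sym (reverse-map not xs)))

isPrefix-applyUpTo : ∀ {A : Set} (ω : InfWord {A}) n → IsPrefix (applyUpTo ω n) ω
isPrefix-applyUpTo ω n i = sym (lookup-applyUpTo ω n i)

isPrefix-map : ∀ {A B : Set} (f : A → B) {ω : InfWord {A}} {ω′ : InfWord {B}} →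
  (∀ n → ω′ n ≡ f (ω n)) → ∀ u → IsPrefix u ω → IsPrefix (map f u) ω′
isPrefix-map f coding (x ∷ u) prefix Fin.zero = trans (coding 0) (cong f (prefix Fin.zero))
isPrefix-map f coding (x ∷ u) prefix (Fin.suc i) =
  isPrefix-map f (coding ∘ suc) u (prefix ∘ Fin.suc) i

map-++₄ : ∀ {A B : Set} (f : A → B) w u v x →
  map f (w ++ u ++ v ++ x) ≡ map f w ++ map f u ++ map f v ++ map f x
map-++₄ f w u v x =
  trans (map-++ f w _)
        (cong (map f w ++_) (trans (map-++ f u _) (cong (map f u ++_) (map-++ f v x))))

length-map-≤ : ∀ {A B : Set} (f : A → B) c u v →
  length v ≤ c * length u → length (map f v) ≤ c * length (map f u)
length-map-≤ f c u v v≤cu rewrite length-map f u | length-map f v = v≤cu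

module _ {A B : Set} {f : A → B} (f-injective : Injective _≡_ _≡_ f)
         {ω : InfWord {A}} {ω′ : InfWord {B}} (coding : ∀ n → ω′ n ≡ f (ω n)) where

  ultPeriodic-decoding : UltPeriodic ω′ → UltPeriodic ω
  ultPeriodic-decoding (p , N , p>0 , period) = p , N , p>0 , λ n N≤n →
    f-injective (trans (sym (coding (n + p))) (trans (period n N≤n) (coding n)))

  unbounded-map : ∀ (U : ℕ → List A) →
    (∀ B → Σ ℕ λ n → (1 ≤ n) × (B < length (U n))) →
    (∀ B → Σ ℕ λ n → (1 ≤ n) × (B < length (map f (U n))))
  unbounded-map U unbounded B with unbounded B
  ... | n , 1≤n , B<|U| = n , 1≤n , subst (B <_) (sym (length-map f (U n))) B<|U|

  bounds-map : ∀ c (U V W : ℕ → List A) →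
    (∀ n → 1 ≤ n → length (V n) ≤ c * length (U n)
                 × length (W n) ≤ c * length (U n)) →
    (∀ n → 1 ≤ n → length (map f (V n)) ≤ c * length (map f (U n))
                 × length (map f (W n)) ≤ c * length (map f (U n)))
  bounds-map c U V W bounds n 1≤n with bounds n 1≤n
  ... | V≤ , W≤ = length-map-≤ f c (U n) (V n) V≤ , length-map-≤ f c (U n) (W n) W≤

  spade-coding : ∀ {c} → Spade c ω → Spade c ω′
  spade-coding {c} (aperiodic , U , V , W , prefix , bounds , unbounded) =
    aperiodic ∘ ultPeriodic-decoding , map f ∘ U , map f ∘ V , map f ∘ W ,
    (λ n 1≤n → subst (λ u → IsPrefix u ω′) (map-++₄ f (W n) (U n) (V n) (U n))
                 (isPrefix-map f coding (W n ++ U n ++ V n ++ U n) (prefix n 1≤n))) ,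
    bounds-map c U V W bounds ,
    unbounded-map U unbounded

  club-coding : ∀ {c} → Club c ω → Club c ω′
  club-coding {c} (aperiodic , U , V , W , prefix , bounds , unbounded) =
    aperiodic ∘ ultPeriodic-decoding , map f ∘ U , map f ∘ V , map f ∘ W ,
    (λ n 1≤n → subst (λ u → IsPrefix u ω′) (mapped-pattern n)
                 (isPrefix-map f coding (W n ++ U n ++ V n ++ reverse (U n))
                    (prefix n 1≤n))) ,
    bounds-map c U V W bounds ,
    unbounded-map U unbounded
    where
    mapped-pattern : ∀ n →
      map f (W n ++ U n ++ V n ++ reverse (U n)) ≡
      map f (W n) ++ map f (U n) ++ map f (V n) ++ reverse (map f (U n))
    mapped-pattern n =
      trans (map-++₄ f (W n) (U n) (V n) (reverse (U n)))
            (cong (λ x → map f (W n) ++ map f (U n) ++ map f (V n) ++ x)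
                  (reverse-map f (U n)))

if-injective : ∀ {A : Set} {a b : A} → a ≢ b →
  Injective _≡_ _≡_ (λ c → if c then b else a)
if-injective a≢b {false} {false} _ = refl
if-injective a≢b {false} {true} a≡b = ⊥-elim (a≢b a≡b)
if-injective a≢b {true} {false} b≡a = ⊥-elim (a≢b (sym b≡a))
if-injective a≢b {true} {true} _ = refl

even⊎odd : ∀ n → (Σ ℕ λ q → n ≡ 2 * q) ⊎ (Σ ℕ λ q → n ≡ suc (2 * q))
even⊎odd zero = inj₁ (0 , refl)
even⊎odd (suc zero) = inj₂ (0 , refl)
even⊎odd (suc (suc n)) with even⊎odd n
... | inj₁ (q , n≡2q) = inj₁ (suc q , trans (cong (2 +_) n≡2q) (sym (*-suc 2 q)))
... | inj₂ (q , n≡1+2q) =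
  inj₂ (suc q , trans (cong (2 +_) n≡1+2q) (cong suc (sym (*-suc 2 q))))

n<2^n : ∀ n → n < 2 ^ n
n<2^n zero = s≤s z≤n
n<2^n (suc n) = begin
  2 + n                  ≡⟨ +-comm (suc n) 1 ⟨
  suc n + 1              ≤⟨ +-mono-≤ (n<2^n n) (m^n>0 2 n) ⟩
  2 ^ n + 2 ^ n          ≡⟨ cong (2 ^ n +_) (+-identityʳ (2 ^ n)) ⟨
  2 ^ n + (2 ^ n + 0)    ∎
  where open ≤-Reasoning

EventualPeriod : ∀ {A : Set} → InfWord {A} → ℕ → ℕ → Set
EventualPeriod ω N p = ∀ n → N ≤ n → ω (n + p) ≡ ω n

half≡⌊n/2⌋ : ∀ n → half n ≡ ⌊ n /2⌋
half≡⌊n/2⌋ zero = refl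
half≡⌊n/2⌋ (suc zero) = refl
half≡⌊n/2⌋ (suc (suc n)) = cong suc (half≡⌊n/2⌋ n)

half-suc≤ : ∀ n → half (suc n) ≤ n
half-suc≤ n = subst (_≤ n) (sym (half≡⌊n/2⌋ (suc n))) (≤-pred (⌊n/2⌋<n n))

half-double : ∀ n → half (2 * n) ≡ n
half-double zero = refl
half-double (suc n) = trans (cong half (*-suc 2 n)) (cong suc (half-double n))

half-suc-double : ∀ n → half (suc (2 * n)) ≡ n
half-suc-double zero = refl
half-suc-double (suc n) =
  trans (cong (half ∘ suc) (*-suc 2 n)) (cong suc (half-suc-double n))

double%2 : ∀ n → 2 * n % 2 ≡ 0
double%2 n = trans (cong (_% 2) (*-comm 2 n)) ([m+kn]%n≡m%n 0 n 2)

suc-double%2 : ∀ n → suc (2 * n) % 2 ≡ 1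
suc-double%2 n = trans (cong (λ m → suc m % 2) (*-comm 2 n)) ([m+kn]%n≡m%n 1 n 2)

ones-fuel-irrelevant : ∀ {k k′} n → n ≤ k → n ≤ k′ → ones k n ≡ ones k′ n
ones-fuel-irrelevant {zero} {zero} n _ _ = refl
ones-fuel-irrelevant {zero} {suc _} zero _ _ = refl
ones-fuel-irrelevant {suc _} {zero} zero _ _ = refl
ones-fuel-irrelevant {suc _} {suc _} zero _ _ = refl
ones-fuel-irrelevant {suc k} {suc k′} (suc n) (s≤s n≤k) (s≤s n≤k′) =
  cong (suc n % 2 +_)
    (ones-fuel-irrelevant (half (suc n)) (≤-trans (half-suc≤ n) n≤k) (≤-trans (half-suc≤ n) n≤k′))

popcount-unfold : ∀ n → popcount n ≡ n % 2 + popcount (half n)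
popcount-unfold zero = refl
popcount-unfold (suc n) =
  cong (suc n % 2 +_) (ones-fuel-irrelevant (half (suc n)) (half-suc≤ n) ≤-refl)

popcount-double : ∀ n → popcount (2 * n) ≡ popcount n
popcount-double n =
  trans (popcount-unfold (2 * n)) (cong₂ _+_ (double%2 n) (cong popcount (half-double n)))

popcount-suc-double : ∀ n → popcount (suc (2 * n)) ≡ suc (popcount n)
popcount-suc-double n =
  trans (popcount-unfold (suc (2 * n)))
        (cong₂ _+_ (suc-double%2 n) (cong popcount (half-suc-double n)))

parity : ℕ → Bool
parity n = not (n % 2 ≡ᵇ 0)

parity-suc : ∀ n → parity (suc n) ≡ not (parity n)
parity-suc zero = refl
parity-suc (suc zero) = refl
parity-suc (suc (suc n)) = parity-suc n

thueMorse-natural : ∀ {A B : Set} (f : A → B) {x y : A} n →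
  f (thueMorse x y n) ≡ thueMorse (f x) (f y) n
thueMorse-natural f n with popcount n % 2
... | zero = refl
... | suc _ = refl

tm : InfWord
tm = thueMorse false true

tm≡parity-popcount : ∀ n → tm n ≡ parity (popcount n)
tm≡parity-popcount n with popcount n % 2
... | zero = refl
... | suc _ = refl

tm-double : ∀ n → tm (2 * n) ≡ tm n
tm-double n = begin
  tm (2 * n)                   ≡⟨ tm≡parity-popcount (2 * n) ⟩
  parity (popcount (2 * n))    ≡⟨ cong parity (popcount-double n) ⟩
  parity (popcount n)          ≡⟨ tm≡parity-popcount n ⟨
  tm n                         ∎
  where open ≡-Reasoning

tm-suc-double : ∀ n → tm (suc (2 * n)) ≡ not (tm n)
tm-suc-double n = begin
  tm (suc (2 * n))                 ≡⟨ tm≡parity-popcount (suc (2 * n)) ⟩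
  parity (popcount (suc (2 * n)))  ≡⟨ cong parity (popcount-suc-double n) ⟩
  parity (suc (popcount n))        ≡⟨ parity-suc (popcount n) ⟩
  not (parity (popcount n))        ≡⟨ cong not (tm≡parity-popcount n) ⟨
  not (tm n)                       ∎
  where open ≡-Reasoning

μ : List Bool → List Bool
μ = concatMap (λ x → x ∷ not x ∷ [])

μ-map-not : ∀ xs → μ (map not xs) ≡ map not (μ xs)
μ-map-not [] = refl
μ-map-not (x ∷ xs) = cong (λ ys → not x ∷ not (not x) ∷ ys) (μ-map-not xs)

applyUpTo-μ : ∀ {f g : ℕ → Bool} →
  (∀ n → f (2 * n) ≡ g n) → (∀ n → f (suc (2 * n)) ≡ not (g n)) →
  ∀ m → applyUpTo f (2 * m) ≡ μ (applyUpTo g m)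
applyUpTo-μ f-even f-odd zero = refl
applyUpTo-μ {f} {g} f-even f-odd (suc m) = begin
  applyUpTo f (2 * suc m)
    ≡⟨ cong (applyUpTo f) (*-suc 2 m) ⟩
  f 0 ∷ f 1 ∷ applyUpTo (f ∘ suc ∘ suc) (2 * m)
    ≡⟨ cong₂ _∷_ (f-even 0) (cong₂ _∷_ (f-odd 0) tail) ⟩
  μ (applyUpTo g (suc m))
    ∎
  where
  open ≡-Reasoning
  f-even′ : ∀ n → f (2 + 2 * n) ≡ g (suc n)
  f-even′ n = trans (cong f (sym (*-suc 2 n))) (f-even (suc n))
  f-odd′ : ∀ n → f (3 + 2 * n) ≡ not (g (suc n))
  f-odd′ n = trans (cong (f ∘ suc) (sym (*-suc 2 n))) (f-odd (suc n))
  tail : applyUpTo (f ∘ suc ∘ suc) (2 * m) ≡ μ (applyUpTo (g ∘ suc) m)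
  tail = applyUpTo-μ f-even′ f-odd′ m

block : ℕ → List Bool
block zero = false ∷ []
block (suc k) = μ (block k)

block≡applyUpTo : ∀ k → block k ≡ applyUpTo tm (2 ^ k)
block≡applyUpTo zero = refl
block≡applyUpTo (suc k) =
  trans (cong μ (block≡applyUpTo k)) (sym (applyUpTo-μ tm-double tm-suc-double (2 ^ k)))

block-isPrefix : ∀ k → IsPrefix (block k) tm
block-isPrefix k =
  subst (λ u → IsPrefix u tm) (sym (block≡applyUpTo k)) (isPrefix-applyUpTo tm (2 ^ k))

length-block : ∀ k → length (block k) ≡ 2 ^ k
length-block k = trans (cong length (block≡applyUpTo k)) (length-applyUpTo tm (2 ^ k))

block-suc : ∀ k → block (suc k) ≡ block k ++ map not (block k)
block-suc zero = refl
block-suc (suc k) = begin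
  μ (block (suc k))                         ≡⟨ cong μ (block-suc k) ⟩
  μ (X ++ map not X)                        ≡⟨ concatMap-++ _ X (map not X) ⟩
  block (suc k) ++ μ (map not X)            ≡⟨ cong (block (suc k) ++_) (μ-map-not X) ⟩
  block (suc k) ++ map not (block (suc k))  ∎
  where
  open ≡-Reasoning
  X = block k

reverse-block-suc-palindrome : ∀ k → reverse (block k) ≡ map not (block k) →
  reverse (block (suc k)) ≡ block (suc k)
reverse-block-suc-palindrome k rev = begin
  reverse (block (suc k))              ≡⟨ cong reverse (block-suc k) ⟩
  reverse (X ++ map not X)             ≡⟨ reverse-++-map-not X ⟩
  map not (reverse X) ++ reverse X     ≡⟨ cong₂ (λ Y Z → map not Y ++ Z) rev rev ⟩
  map not (map not X) ++ map not X     ≡⟨ cong (_++ map not X) (map-not-involutive X) ⟩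
  X ++ map not X                       ≡⟨ block-suc k ⟨
  block (suc k)                        ∎
  where
  open ≡-Reasoning
  X = block k

reverse-block-suc-complement : ∀ k → reverse (block k) ≡ block k →
  reverse (block (suc k)) ≡ map not (block (suc k))
reverse-block-suc-complement k rev = begin
  reverse (block (suc k))              ≡⟨ cong reverse (block-suc k) ⟩
  reverse (X ++ map not X)             ≡⟨ reverse-++-map-not X ⟩
  map not (reverse X) ++ reverse X     ≡⟨ cong₂ (λ Y Z → map not Y ++ Z) rev rev′ ⟩
  map not X ++ map not (map not X)     ≡⟨ map-++ not X (map not X) ⟨
  map not (X ++ map not X)             ≡⟨ cong (map not) (block-suc k) ⟨
  map not (block (suc k))              ∎
  where
  open ≡-Reasoning
  X = block k
  rev′ : reverse X ≡ map not (map not X)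
  rev′ = trans rev (sym (map-not-involutive X))

reverse-block-odd : ∀ k → reverse (block (suc (2 * k))) ≡ map not (block (suc (2 * k)))
reverse-block-odd zero = refl
reverse-block-odd (suc k) = subst OddBlockReversal (sym (*-suc 2 k))
  (reverse-block-suc-complement (2 + 2 * k)
    (reverse-block-suc-palindrome (suc (2 * k)) (reverse-block-odd k)))
  where
  OddBlockReversal : ℕ → Set
  OddBlockReversal j = reverse (block (suc j)) ≡ map not (block (suc j))

block-suc-suc : ∀ k →
  block (suc (suc k)) ≡ block k ++ (map not (block k) ++ map not (block k)) ++ block k
block-suc-suc k = begin
  block (suc (suc k))                       ≡⟨ block-suc (suc k) ⟩
  block (suc k) ++ map not (block (suc k))  ≡⟨ cong (λ Z → Z ++ map not Z) (block-suc k) ⟩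
  (X ++ Y) ++ map not (X ++ Y)              ≡⟨ cong ((X ++ Y) ++_) (map-++ not X Y) ⟩
  (X ++ Y) ++ (Y ++ map not Y)              ≡⟨ cong (((X ++ Y) ++_) ∘ (Y ++_)) (map-not-involutive X) ⟩
  (X ++ Y) ++ (Y ++ X)                      ≡⟨ ++-assoc X Y (Y ++ X) ⟩
  X ++ (Y ++ (Y ++ X))                      ≡⟨ cong (X ++_) (++-assoc Y Y X) ⟨
  X ++ (Y ++ Y) ++ X                        ∎
  where
  open ≡-Reasoning
  X = block k
  Y = map not X

block-unbounded : ∀ {f : ℕ → ℕ} → (∀ n → n ≤ f n) →
  ∀ B → Σ ℕ λ n → (1 ≤ n) × (B < length (block (f n)))
block-unbounded {f} n≤f B = suc B , s≤s z≤n , (begin-strict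
  B                          <⟨ n<1+n B ⟩
  suc B                      ≤⟨ n≤f (suc B) ⟩
  f (suc B)                  <⟨ n<2^n (f (suc B)) ⟩
  2 ^ f (suc B)              ≡⟨ length-block (f (suc B)) ⟨
  length (block (f (suc B))) ∎)
  where open ≤-Reasoning

tm-halve-even-period : ∀ {N q} → EventualPeriod tm N (2 * q) → EventualPeriod tm N q
tm-halve-even-period {q = q} period n N≤n = begin
  tm (n + q)           ≡⟨ tm-double (n + q) ⟨
  tm (2 * (n + q))     ≡⟨ cong tm (*-distribˡ-+ 2 n q) ⟩
  tm (2 * n + 2 * q)   ≡⟨ period (2 * n) (≤-trans N≤n (m≤n*m n 2)) ⟩
  tm (2 * n)           ≡⟨ tm-double n ⟩
  tm n                 ∎
  where open ≡-Reasoning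

tm-no-odd-period : ∀ {N q} → ¬ EventualPeriod tm N (suc (2 * q))
tm-no-odd-period {N} {q} period = not-¬ refl (begin
  tm N               ≡⟨ tm-double N ⟨
  tm (2 * N)         ≡⟨ eventually-constant (2 * N) (m≤n*m N 2) ⟨
  tm (suc (2 * N))   ≡⟨ tm-suc-double N ⟩
  not (tm N)         ∎)
  where
  open ≡-Reasoning
  N≤2n : ∀ n → N ≤ n → N ≤ 2 * n
  N≤2n n N≤n = ≤-trans N≤n (m≤n*m n 2)
  odd-shift : ∀ n → suc (2 * (n + q)) ≡ 2 * n + suc (2 * q)
  odd-shift n = trans (cong suc (*-distribˡ-+ 2 n q)) (sym (+-suc (2 * n) (2 * q)))
  period-at-even : ∀ n → N ≤ n → not (tm (n + q)) ≡ tm n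
  period-at-even n N≤n = begin
    not (tm (n + q))          ≡⟨ tm-suc-double (n + q) ⟨
    tm (suc (2 * (n + q)))    ≡⟨ cong tm (odd-shift n) ⟩
    tm (2 * n + suc (2 * q))  ≡⟨ period (2 * n) (N≤2n n N≤n) ⟩
    tm (2 * n)                ≡⟨ tm-double n ⟩
    tm n                      ∎
  period-at-odd : ∀ n → N ≤ n → tm (suc (n + q)) ≡ not (tm n)
  period-at-odd n N≤n = begin
    tm (suc (n + q))                ≡⟨ tm-double (suc (n + q)) ⟨
    tm (2 * suc (n + q))            ≡⟨ cong tm (trans (*-suc 2 (n + q)) (cong suc (odd-shift n))) ⟩
    tm (suc (2 * n) + suc (2 * q))  ≡⟨ period (suc (2 * n)) (m≤n⇒m≤1+n (N≤2n n N≤n)) ⟩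
    tm (suc (2 * n))                ≡⟨ tm-suc-double n ⟩
    not (tm n)                      ∎
  eventually-constant : ∀ n → N ≤ n → tm (suc n) ≡ tm n
  eventually-constant n N≤n = begin
    tm (suc n)                ≡⟨ period-at-even (suc n) (m≤n⇒m≤1+n N≤n) ⟨
    not (tm (suc (n + q)))    ≡⟨ cong not (period-at-odd n N≤n) ⟩
    not (not (tm n))          ≡⟨ not-involutive (tm n) ⟩
    tm n                      ∎

tm-aperiodic : ¬ UltPeriodic tm
tm-aperiodic (p , N , p>0 , period) = <-rec NoPeriod no-period p p>0 N period
  where
  NoPeriod : ℕ → Set
  NoPeriod p = 0 < p → ∀ N → ¬ EventualPeriod tm N p
  no-period : ∀ p → (∀ {q} → q < p → NoPeriod q) → NoPeriod p
  no-period p shorter p>0 N period with even⊎odd p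
  ... | inj₁ (zero , refl) = n≮0 p>0
  ... | inj₂ (q , refl) = tm-no-odd-period {N} {q} period
  ... | inj₁ (suc q , refl) = shorter half<p (s≤s z≤n) N (tm-halve-even-period period)
    where
    half<p : suc q < 2 * suc q
    half<p = subst (suc q <_) (*-comm (suc q) 2) (m<m*n (suc q) 2 (s≤s (s≤s z≤n)))

tm-spade : Spade 2 tm
tm-spade = tm-aperiodic , block , gap , (λ _ → []) ,
  (λ k _ → subst (λ u → IsPrefix u tm) (block-suc-suc k) (block-isPrefix (suc (suc k)))) ,
  (λ k _ → ≤-reflexive (length-gap k) , z≤n) ,
  block-unbounded (λ _ → ≤-refl)
  where
  gap : ℕ → List Bool
  gap k = map not (block k) ++ map not (block k)
  length-gap : ∀ k → length (gap k) ≡ 2 * length (block k)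
  length-gap k = begin
    length (map not X ++ map not X)           ≡⟨ length-++ (map not X) ⟩
    length (map not X) + length (map not X)   ≡⟨ cong (λ m → m + m) (length-map not X) ⟩
    length X + length X                       ≡⟨ cong (length X +_) (+-identityʳ (length X)) ⟨
    2 * length X                              ∎
    where
    open ≡-Reasoning
    X = block k

tm-club : Club 0 tm
tm-club = tm-aperiodic , (λ k → block (suc (2 * k))) , (λ _ → []) , (λ _ → []) ,
  (λ k _ → subst (λ u → IsPrefix u tm) (palindromic-prefix k) (block-isPrefix (2 + 2 * k))) ,
  (λ _ _ → z≤n , z≤n) ,
  block-unbounded (λ n → m≤n⇒m≤1+n (m≤n*m n 2))
  where
  palindromic-prefix : ∀ k →
    block (2 + 2 * k) ≡ block (suc (2 * k)) ++ reverse (block (suc (2 * k)))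
  palindromic-prefix k =
    trans (block-suc (suc (2 * k))) (cong (block (suc (2 * k)) ++_) (sym (reverse-block-odd k)))

proposition2p3 : {A : Set} (a b : A) → ¬ (a ≡ b) →
    Spade 2 (thueMorse a b) × Club 0 (thueMorse a b)
proposition2p3 a b a≢b =
  spade-coding choose-injective coding {2} tm-spade ,
  club-coding choose-injective coding {0} tm-club
  where
  choose : Bool → _
  choose c = if c then b else a
  choose-injective : Injective _≡_ _≡_ choose
  choose-injective = if-injective a≢b
  coding : ∀ n → thueMorse a b n ≡ choose (tm n)
  coding n = sym (thueMorse-natural choose n)
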